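{- Let $q$ be a prime power. For all $m,n\in\mathbb{N}$, $h_q(mn)\ge h_q(m)+h_q(n)$.
   Context: For $n\in\mathbb{N}$, let $\sigma:\mathbb{F}_q^n\to\mathbb{F}_q^n$ be the cyclic shift $\sigma(\sum_{i=0}^{n-1}x_ie_i)=\sum_{i=0}^{n-1}x_ie_{i+1}$ (indices mod $n$). A subspace $U\le\mathbb{F}_q^n$ is cyclically covering if $\bigcup_{i=0}^{n-1}\sigma^i(U)=\mathbb{F}_q^n$. $h_q(n)$ denotes the largest possible codimension of a cyclically covering subspace of $\mathbb{F}_q^n$. -}

module Defs where

open import Level using (Level; _⊔_) renaming (suc to lsuc)
open import Data.Nat using (ℕ; zero; suc; _^_) renaming (_+_ to _+ℕ_; _≤_ to _≤ℕ_)
open import Data.Nat.Primality using (Prime)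
open import Data.Fin using (Fin; zero; suc; fromℕ; inject₁; toℕ)
open import Data.Product using (Σ; ∃; _×_; _,_)
open import Function using (_∘_)
open import Relation.Nullary using (¬_)
open import Relation.Binary.PropositionalEquality using (_≡_)
open import Algebra.Bundles using (CommutativeRing)

IsPrimePower : ℕ → Set
IsPrimePower q = Σ ℕ λ p → Σ ℕ λ k → Prime p × q ≡ p ^ suc k

record Field (c ℓ : Level) : Set (lsuc (c ⊔ ℓ)) where
  field
    commutativeRing : CommutativeRing c ℓ
  open CommutativeRing commutativeRing public
  field
    1≉0     : ¬ (1# ≈ 0#)
    inverse : ∀ x → ¬ (x ≈ 0#) → Σ Carrier λ y → (x * y) ≈ 1#

HasCard : ∀ {c ℓ} → Field c ℓ → ℕ → Set (c ⊔ ℓ)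
HasCard F q =
  Σ (Fin q → Carrier) λ f →
    (∀ i j → f i ≈ f j → i ≡ j) × (∀ x → Σ (Fin q) λ i → f i ≈ x)
  where open Field F

module LinAlg {c ℓ : Level} (F : Field c ℓ) where
  open Field F using (Carrier; _≈_; _+_; _*_; 0#)

  Vec : ℕ → Set c
  Vec n = Fin n → Carrier

  _≈ᵥ_ : ∀ {n} → Vec n → Vec n → Set ℓ
  u ≈ᵥ v = ∀ i → u i ≈ v i

  0ᵥ : ∀ {n} → Vec n
  0ᵥ _ = 0#

  _+ᵥ_ : ∀ {n} → Vec n → Vec n → Vec n
  (u +ᵥ v) i = u i + v i

  _·_ : ∀ {n} → Carrier → Vec n → Vec n
  (a · v) i = a * v i

  lincomb : ∀ {n d} → (Fin d → Carrier) → (Fin d → Vec n) → Vec n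
  lincomb {d = zero}  cs bs = 0ᵥ
  lincomb {d = suc d} cs bs = (cs zero · bs zero) +ᵥ lincomb (cs ∘ suc) (bs ∘ suc)

  record Subspace (n : ℕ) : Set (lsuc (c ⊔ ℓ)) where
    field
      _∈U    : Vec n → Set (c ⊔ ℓ)
      resp   : ∀ {u v} → u ≈ᵥ v → u ∈U → v ∈U
      zero∈  : 0ᵥ ∈U
      +-closed : ∀ {u v} → u ∈U → v ∈U → (u +ᵥ v) ∈U
      ·-closed : ∀ a {v} → v ∈U → (a · v) ∈U
  open Subspace public

  HasDim : ∀ {n} → Subspace n → ℕ → Set (c ⊔ ℓ)
  HasDim {n} U d =
    Σ (Fin d → Vec n) λ b →
      (∀ i → _∈U U (b i)) ×
      (∀ (cs : Fin d → Carrier) → lincomb cs b ≈ᵥ 0ᵥ → ∀ i → cs i ≈ 0#) ×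
      (∀ v → _∈U U v → Σ (Fin d → Carrier) λ cs → v ≈ᵥ lincomb cs b)

  -- U has codimension k in F^n: dim U = n - k (with k ≤ n implicit, since dim ≥ 0)
  HasCodim : ∀ {n} → Subspace n → ℕ → Set (c ⊔ ℓ)
  HasCodim {n} U k = Σ ℕ λ d → HasDim U d × (d +ℕ k ≡ n)

  prev : ∀ {n} → Fin n → Fin n
  prev {suc n} zero    = fromℕ n
  prev {suc n} (suc j) = inject₁ j

  -- cyclic shift σ(Σ x_i e_i) = Σ x_i e_{i+1}, i.e. (σ x)_j = x_{j-1}
  σ : ∀ {n} → Vec n → Vec n
  σ x j = x (prev j)

  σ^ : ∀ {n} → ℕ → Vec n → Vec n
  σ^ zero    x = x
  σ^ (suc i) x = σ (σ^ i x)

  CyclicallyCovering : ∀ {n} → Subspace n → Set (c ⊔ ℓ)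
  CyclicallyCovering {n} U =
    ∀ (v : Vec n) → Σ (Fin n) λ i → Σ (Vec n) λ u → _∈U U u × (σ^ (toℕ i) u ≈ᵥ v)

  IsH : ℕ → ℕ → Set (lsuc (c ⊔ ℓ))
  IsH n h =
    (Σ (Subspace n) λ U → CyclicallyCovering U × HasCodim U h) ×
    (∀ (U : Subspace n) k → CyclicallyCovering U → HasCodim U k → k ≤ℕ h)

module Submission where

-- Let U ≤ F^m and V ≤ F^n be cyclically covering, of codimensions h_U and
-- h_V.  View F^(mn) as m × n matrices (index n·i + j is entry (i, j)), so
-- that the cyclic shift of F^(mn) moves every entry one step along the rows,
-- read in order.  Let W be the space of matrices whose first column lies in
-- U and whose vector of column sums lies in V.
--
--   * W is cyclically covering: a shift by b < n realigns the column sums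
--     of any matrix into V, and a further shift by whole rows (a multiple of
--     n) realigns its first column into U without changing column sums.
--   * codim W = h_U + h_V: W is linearly isomorphic to
--     U × (V ∩ {w₀ = 0}) × F^((m-1)(n-1)), and since V contains the all-ones
--     vector, V ∩ {w₀ = 0} has dimension dim V - 1.
--
-- Finiteness of the field is only used to decide whether a scalar is zero
-- (finding a pivot in a basis).

open import Defs
open import Level using (Level; _⊔_; Lift; lift)
open import Data.Nat using (ℕ)

module Rotation where

  open import Data.Nat using (suc; _+_; _*_; _<_; NonZero)
  open import Data.Nat.Properties using (+-assoc; +-comm; *-comm)
  open import Data.Nat.DivMod
  open import Data.Fin using (Fin; toℕ; fromℕ<; combine)
  open import Data.Fin.Properties using (toℕ-fromℕ<; toℕ-injective; toℕ<n; toℕ-combine)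
  open import Relation.Binary.PropositionalEquality
  open import Data.Nat.Solver using (module +-*-Solver)
  open +-*-Solver using (solve; _:+_; _:*_; _:=_)

  rotate : ∀ {N} → ℕ → Fin N → Fin N
  rotate {suc N} s k = fromℕ< (m%n<n (toℕ k + s) (suc N))

  toℕ-rotate : ∀ {N} s (k : Fin (suc N)) → toℕ (rotate s k) ≡ (toℕ k + s) % suc N
  toℕ-rotate {N} s k = toℕ-fromℕ< (m%n<n (toℕ k + s) (suc N))

  %-absorbˡ : ∀ a b N .{{_ : NonZero N}} → (a % N + b) % N ≡ (a + b) % N
  %-absorbˡ a b N = begin
    (a % N + b) % N            ≡⟨ %-distribˡ-+ (a % N) b N ⟩
    (a % N % N + b % N) % N    ≡⟨ cong (λ x → (x + b % N) % N) (m%n%n≡m%n a N) ⟩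
    (a % N + b % N) % N        ≡⟨ %-distribˡ-+ a b N ⟨
    (a + b) % N                ∎
    where open ≡-Reasoning

  rotate-zero : ∀ {N} (k : Fin N) → rotate 0 k ≡ k
  rotate-zero {suc N} k = toℕ-injective (begin
    toℕ (rotate 0 k)    ≡⟨ toℕ-rotate 0 k ⟩
    (toℕ k + 0) % suc N ≡⟨ cong (_% suc N) (+-comm (toℕ k) 0) ⟩
    toℕ k % suc N       ≡⟨ m<n⇒m%n≡m (toℕ<n k) ⟩
    toℕ k               ∎)
    where open ≡-Reasoning

  rotate-rotate : ∀ {N} a b (k : Fin N) → rotate a (rotate b k) ≡ rotate (b + a) k
  rotate-rotate {suc N} a b k = toℕ-injective (begin
    toℕ (rotate a (rotate b k))      ≡⟨ toℕ-rotate a (rotate b k) ⟩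
    (toℕ (rotate b k) + a) % suc N   ≡⟨ cong (λ x → (x + a) % suc N) (toℕ-rotate b k) ⟩
    ((toℕ k + b) % suc N + a) % suc N ≡⟨ %-absorbˡ (toℕ k + b) a (suc N) ⟩
    (toℕ k + b + a) % suc N          ≡⟨ cong (_% suc N) (+-assoc (toℕ k) b a) ⟩
    (toℕ k + (b + a)) % suc N        ≡⟨ toℕ-rotate (b + a) k ⟨
    toℕ (rotate (b + a) k)           ∎)
    where open ≡-Reasoning

  -- Fin (m * n) is an m × n grid, row i / column j being the index n * i + j
  -- ('combine i j').  Reducing a grid position modulo m * n reduces its row
  -- modulo m and keeps its column.
  %-grid : ∀ m n a r → r < suc n →
           (suc n * a + r) % (suc m * suc n) ≡ suc n * (a % suc m) + r
  %-grid m n a r r<n = begin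
    (N * a + r) % (M * N)   ≡⟨ cong (λ x → (x + r) % (M * N)) (*-comm N a) ⟩
    (a * N + r) % (M * N)   ≡⟨ [m*n+o]%[p*n]≡[m*n]%[p*n]+o a M r<n ⟩
    (a * N) % (M * N) + r   ≡⟨ cong (_+ r) (m%n*o≡m*o%[n*o] a M N) ⟨
    (a % M) * N + r         ≡⟨ cong (_+ r) (*-comm (a % M) N) ⟩
    N * (a % M) + r         ∎
    where
    open ≡-Reasoning
    M N : ℕ
    M = suc m
    N = suc n

  rotate-rows : ∀ {m n} a (i : Fin (suc m)) (j : Fin (suc n)) →
                rotate (suc n * a) (combine i j) ≡ combine (rotate a i) j
  rotate-rows {m} {n} a i j = toℕ-injective (begin
    toℕ (rotate (N * a) (combine i j))             ≡⟨ toℕ-rotate (N * a) (combine i j) ⟩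
    (toℕ (combine i j) + N * a) % (M * N)          ≡⟨ cong (λ x → (x + N * a) % (M * N)) (toℕ-combine i j) ⟩
    (N * toℕ i + toℕ j + N * a) % (M * N)          ≡⟨ cong (_% (M * N)) (regroup N (toℕ i) (toℕ j) a) ⟩
    (N * (toℕ i + a) + toℕ j) % (M * N)            ≡⟨ %-grid m n (toℕ i + a) (toℕ j) (toℕ<n j) ⟩
    N * ((toℕ i + a) % M) + toℕ j                  ≡⟨ cong (λ x → N * x + toℕ j) (toℕ-rotate a i) ⟨
    N * toℕ (rotate a i) + toℕ j                   ≡⟨ toℕ-combine (rotate a i) j ⟨
    toℕ (combine (rotate a i) j)                   ∎)
    where
    open ≡-Reasoning
    M N : ℕ
    M = suc m
    N = suc n
    regroup : ∀ N t u a → N * t + u + N * a ≡ N * (t + a) + u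
    regroup = solve 4 (λ N t u a → N :* t :+ u :+ N :* a := N :* (t :+ a) :+ u) refl

  rotate-combine : ∀ {m n} s (i : Fin (suc m)) (j : Fin (suc n)) →
                   rotate s (combine i j) ≡ combine (rotate ((toℕ j + s) / suc n) i) (rotate s j)
  rotate-combine {m} {n} s i j = toℕ-injective (begin
    toℕ (rotate s (combine i j))                  ≡⟨ toℕ-rotate s (combine i j) ⟩
    (toℕ (combine i j) + s) % (M * N)             ≡⟨ cong (λ x → (x + s) % (M * N)) (toℕ-combine i j) ⟩
    (N * toℕ i + toℕ j + s) % (M * N)             ≡⟨ cong (_% (M * N)) carry ⟩
    (N * (toℕ i + q) + r) % (M * N)               ≡⟨ %-grid m n (toℕ i + q) r (m%n<n (toℕ j + s) N) ⟩
    N * ((toℕ i + q) % M) + r                     ≡⟨ cong₂ (λ x y → N * x + y) (toℕ-rotate q i) (toℕ-rotate s j) ⟨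
    N * toℕ (rotate q i) + toℕ (rotate s j)       ≡⟨ toℕ-combine (rotate q i) (rotate s j) ⟨
    toℕ (combine (rotate q i) (rotate s j))       ∎)
    where
    open ≡-Reasoning
    M N q r : ℕ
    M = suc m
    N = suc n
    q = (toℕ j + s) / N
    r = (toℕ j + s) % N
    carry : N * toℕ i + toℕ j + s ≡ N * (toℕ i + q) + r
    carry = begin
      N * toℕ i + toℕ j + s          ≡⟨ +-assoc (N * toℕ i) (toℕ j) s ⟩
      N * toℕ i + (toℕ j + s)        ≡⟨ cong (N * toℕ i +_) (m≡m%n+[m/n]*n (toℕ j + s) N) ⟩
      N * toℕ i + (r + q * N)        ≡⟨ solve 4 (λ N t r q → N :* t :+ (r :+ q :* N) := N :* (t :+ q) :+ r) refl N (toℕ i) r q ⟩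
      N * (toℕ i + q) + r            ∎

  rotate-mod : ∀ {n} a b (j : Fin (suc n)) → rotate (suc n * a + b) j ≡ rotate b j
  rotate-mod {n} a b j = toℕ-injective (begin
    toℕ (rotate (N * a + b) j)       ≡⟨ toℕ-rotate (N * a + b) j ⟩
    (toℕ j + (N * a + b)) % N        ≡⟨ cong (_% N) (solve 4 (λ t N a b → t :+ (N :* a :+ b) := t :+ b :+ a :* N) refl (toℕ j) N a b) ⟩
    (toℕ j + b + a * N) % N          ≡⟨ [m+kn]%n≡m%n (toℕ j + b) a N ⟩
    (toℕ j + b) % N                  ≡⟨ toℕ-rotate b j ⟨
    toℕ (rotate b j)                 ∎)
    where
    open ≡-Reasoning
    N : ℕ
    N = suc n

open Rotation

module Grid where

  open import Data.Nat using (_*_)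
  open import Data.Fin using (Fin; combine; remQuot)
  open import Data.Fin.Properties using (remQuot-combine; combine-remQuot)
  open import Data.Product using (proj₁; proj₂; uncurry)
  open import Relation.Binary.PropositionalEquality using (_≡_; cong; subst)

  grid : ∀ {x} {A : Set x} {a b} → (Fin a → Fin b → A) → Fin (a * b) → A
  grid {b = b} g k = uncurry g (remQuot b k)

  grid-combine : ∀ {x} {A : Set x} {a b} (g : Fin a → Fin b → A) i j → grid g (combine i j) ≡ g i j
  grid-combine g i j = cong (uncurry g) (remQuot-combine i j)

  grid-elim : ∀ {p a b} (P : Fin (a * b) → Set p) → (∀ i j → P (combine i j)) → ∀ k → P k
  grid-elim {a = a} {b} P at-grid k =
    subst P (combine-remQuot {a} b k) (at-grid (proj₁ (remQuot {a} b k)) (proj₂ (remQuot {a} b k)))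

open Grid

module Linear {c ℓ : Level} (F : Field c ℓ) where
  open Field F hiding (zero)
  open LinAlg F
  open import Data.Nat using (ℕ; zero; suc) renaming (_+_ to _+ℕ_)
  open import Data.Fin using (Fin; zero; suc; punchIn; _↑ˡ_; _↑ʳ_; splitAt)
  open import Data.Fin.Properties using (_≟_; any?; splitAt⁻¹-↑ˡ; splitAt⁻¹-↑ʳ; punchInᵢ≢i)
  open import Data.Vec.Functional using (_++_; take; drop; insertAt)
  open import Data.Vec.Functional.Properties using (lookup-++ˡ; lookup-++ʳ; insertAt-lookup; insertAt-punchIn)
  open import Data.Product using (Σ; _×_; _,_; proj₁; proj₂)
  open import Data.Sum using (inj₁; inj₂)
  open import Data.Sum.Properties using ([,]-map)
  open import Data.Unit using (⊤; tt)
  open import Data.Empty using (⊥-elim)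
  open import Function using (_∘_)
  open import Relation.Nullary using (Dec; yes; no; ¬_; ¬?; contradiction)
  open import Relation.Nullary.Decidable using (decidable-stable)
  open import Relation.Binary.PropositionalEquality as ≡ using (_≡_)
  open import Algebra.Properties.Semiring.Sum semiring
    using (sum; sum-cong-≋; ∑-distrib-+; *-distribˡ-sum; sum-remove)
  open import Algebra.Properties.Ring ring using (-‿+-comm; -‿distribʳ-*; -‿distribˡ-*; -0#≈0#)
  open import Algebra.Properties.CommutativeSemigroup +-commutativeSemigroup using (interchange)
  open import Relation.Binary.Reasoning.Setoid setoid

  record IsLinear {N : ℕ} (f : Vec N → Carrier) : Set (c ⊔ ℓ) where
    field
      cong-≈      : ∀ {u v} → u ≈ᵥ v → f u ≈ f v
      additive    : ∀ u v → f (u +ᵥ v) ≈ f u + f v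
      homogeneous : ∀ a v → f (a · v) ≈ a * f v

    preserves-0 : f 0ᵥ ≈ 0#
    preserves-0 = begin
      f 0ᵥ          ≈⟨ cong-≈ (λ _ → sym (zeroˡ 0#)) ⟩
      f (0# · 0ᵥ)   ≈⟨ homogeneous 0# 0ᵥ ⟩
      0# * f 0ᵥ     ≈⟨ zeroˡ _ ⟩
      0#            ∎
  open IsLinear public

  IsLinearMap : ∀ {M N} → (Vec M → Vec N) → Set (c ⊔ ℓ)
  IsLinearMap L = ∀ j → IsLinear (λ v → L v j)

  coordinate-linear : ∀ {N} (i : Fin N) → IsLinear (λ v → v i)
  coordinate-linear i = record
    { cong-≈ = λ u≈v → u≈v i ; additive = λ _ _ → refl ; homogeneous = λ _ _ → refl }

  +-linear : ∀ {N} {f g : Vec N → Carrier} → IsLinear f → IsLinear g → IsLinear (λ v → f v + g v)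
  +-linear f-lin g-lin = record
    { cong-≈      = λ u≈v → +-cong (cong-≈ f-lin u≈v) (cong-≈ g-lin u≈v)
    ; additive    = λ u v → trans (+-cong (additive f-lin u v) (additive g-lin u v)) (interchange _ _ _ _)
    ; homogeneous = λ a v → trans (+-cong (homogeneous f-lin a v) (homogeneous g-lin a v)) (sym (distribˡ a _ _))
    }

  neg-linear : ∀ {N} {f : Vec N → Carrier} → IsLinear f → IsLinear (λ v → - f v)
  neg-linear f-lin = record
    { cong-≈      = λ u≈v → -‿cong (cong-≈ f-lin u≈v)
    ; additive    = λ u v → trans (-‿cong (additive f-lin u v)) (sym (-‿+-comm _ _))
    ; homogeneous = λ a v → trans (-‿cong (homogeneous f-lin a v)) (-‿distribʳ-* a _)
    }

  scaled-linear : ∀ {N} {f : Vec N → Carrier} → IsLinear f → ∀ b → IsLinear (λ v → f v * b)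
  scaled-linear f-lin b = record
    { cong-≈      = λ u≈v → *-congʳ (cong-≈ f-lin u≈v)
    ; additive    = λ u v → trans (*-congʳ (additive f-lin u v)) (distribʳ b _ _)
    ; homogeneous = λ a v → trans (*-congʳ (homogeneous f-lin a v)) (*-assoc a _ b)
    }

  sum-linear : ∀ {N K} {f : Fin K → Vec N → Carrier} → (∀ k → IsLinear (f k)) →
               IsLinear (λ v → sum (λ k → f k v))
  sum-linear {K = K} {f} f-lin = record
    { cong-≈      = λ u≈v → sum-cong-≋ {K} (λ k → cong-≈ (f-lin k) u≈v)
    ; additive    = λ u v → trans (sum-cong-≋ {K} (λ k → additive (f-lin k) u v))
                                  (∑-distrib-+ (λ k → f k u) (λ k → f k v))
    ; homogeneous = λ a v → trans (sum-cong-≋ {K} (λ k → homogeneous (f-lin k) a v))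
                                  (sym (*-distribˡ-sum a (λ k → f k v)))
    }

  linear-lincomb : ∀ {N d} {f : Vec N → Carrier} → IsLinear f →
                   (cs : Fin d → Carrier) (bs : Fin d → Vec N) → f (lincomb cs bs) ≈ sum (λ l → cs l * f (bs l))
  linear-lincomb {d = zero}  f-lin cs bs = preserves-0 f-lin
  linear-lincomb {d = suc d} {f} f-lin cs bs = begin
    f ((cs zero · bs zero) +ᵥ lincomb (cs ∘ suc) (bs ∘ suc))        ≈⟨ additive f-lin _ _ ⟩
    f (cs zero · bs zero) + f (lincomb (cs ∘ suc) (bs ∘ suc))        ≈⟨ +-cong (homogeneous f-lin (cs zero) (bs zero))
                                                                               (linear-lincomb f-lin (cs ∘ suc) (bs ∘ suc)) ⟩
    cs zero * f (bs zero) + sum (λ l → cs (suc l) * f (bs (suc l)))  ∎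

  lincomb-coordinate : ∀ {N d} (cs : Fin d → Carrier) (bs : Fin d → Vec N) i →
                       lincomb cs bs i ≈ sum (λ l → cs l * bs l i)
  lincomb-coordinate cs bs i = linear-lincomb (coordinate-linear i) cs bs

  lincomb-map : ∀ {M N d} {L : Vec M → Vec N} → IsLinearMap L →
                (cs : Fin d → Carrier) (bs : Fin d → Vec M) → L (lincomb cs bs) ≈ᵥ lincomb cs (L ∘ bs)
  lincomb-map L-lin cs bs j =
    trans (linear-lincomb (L-lin j) cs bs) (sym (lincomb-coordinate cs _ j))

  lincomb-cong : ∀ {N N' d} {cs ds : Fin d → Carrier} {bs : Fin d → Vec N} {bs' : Fin d → Vec N'} {i i'} →
                 (∀ l → cs l ≈ ds l) → (∀ l → bs l i ≈ bs' l i') → lincomb cs bs i ≈ lincomb ds bs' i'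
  lincomb-cong {d = zero}  c≈ b≈ = refl
  lincomb-cong {d = suc d} c≈ b≈ = +-cong (*-cong (c≈ zero) (b≈ zero)) (lincomb-cong (c≈ ∘ suc) (b≈ ∘ suc))

  lincomb-vanishing : ∀ {N d} (cs : Fin d → Carrier) (bs : Fin d → Vec N) i →
                      (∀ l → cs l * bs l i ≈ 0#) → lincomb cs bs i ≈ 0#
  lincomb-vanishing {d = zero}  cs bs i terms≈0 = refl
  lincomb-vanishing {d = suc d} cs bs i terms≈0 =
    trans (+-cong (terms≈0 zero) (lincomb-vanishing (cs ∘ suc) (bs ∘ suc) i (terms≈0 ∘ suc))) (+-identityˡ 0#)

  lincomb-zero : ∀ {N d} (cs : Fin d → Carrier) (bs : Fin d → Vec N) → (∀ l → cs l ≈ 0#) → lincomb cs bs ≈ᵥ 0ᵥ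
  lincomb-zero cs bs cs≈0 i = lincomb-vanishing cs bs i (λ l → trans (*-congʳ (cs≈0 l)) (zeroˡ _))

  lincomb-+ : ∀ {N d} (cs ds : Fin d → Carrier) (bs : Fin d → Vec N) →
              lincomb (λ l → cs l + ds l) bs ≈ᵥ (lincomb cs bs +ᵥ lincomb ds bs)
  lincomb-+ {d = zero}  cs ds bs i = sym (+-identityˡ 0#)
  lincomb-+ {d = suc d} cs ds bs i =
    trans (+-cong (distribʳ _ _ _) (lincomb-+ (cs ∘ suc) (ds ∘ suc) (bs ∘ suc) i)) (interchange _ _ _ _)

  lincomb-· : ∀ {N d} a (cs : Fin d → Carrier) (bs : Fin d → Vec N) →
              lincomb (λ l → a * cs l) bs ≈ᵥ (a · lincomb cs bs)
  lincomb-· {d = zero}  a cs bs i = sym (zeroʳ a)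
  lincomb-· {d = suc d} a cs bs i =
    trans (+-cong (*-assoc _ _ _) (lincomb-· a (cs ∘ suc) (bs ∘ suc) i)) (sym (distribˡ a _ _))

  lincomb-pivot : ∀ {N D} (k : Fin (suc D)) (cs : Fin (suc D) → Carrier) (bs : Fin (suc D) → Vec N) →
                  lincomb cs bs ≈ᵥ ((cs k · bs k) +ᵥ lincomb (cs ∘ punchIn k) (bs ∘ punchIn k))
  lincomb-pivot k cs bs i = begin
    lincomb cs bs i                                      ≈⟨ lincomb-coordinate cs bs i ⟩
    sum (λ l → cs l * bs l i)                            ≈⟨ sum-remove {i = k} (λ l → cs l * bs l i) ⟩
    cs k * bs k i + sum (λ l → cs (punchIn k l) * bs (punchIn k l) i)
                                                         ≈⟨ +-congˡ (sym (lincomb-coordinate (cs ∘ punchIn k) (bs ∘ punchIn k) i)) ⟩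
    cs k * bs k i + lincomb (cs ∘ punchIn k) (bs ∘ punchIn k) i ∎

  lincomb-++ : ∀ {N d e} (cs : Fin (d +ℕ e) → Carrier) (f : Fin d → Vec N) (g : Fin e → Vec N) →
               lincomb cs (f ++ g) ≈ᵥ (lincomb (take d cs) f +ᵥ lincomb (drop d cs) g)
  lincomb-++ {d = zero}  cs f g i = sym (+-identityˡ _)
  lincomb-++ {d = suc d} cs f g i = trans (+-congˡ (trans tail-split (lincomb-++ (cs ∘ suc) (f ∘ suc) g i)))
                                          (sym (+-assoc _ _ _))
    where
    tail-split : lincomb (cs ∘ suc) ((f ++ g) ∘ suc) i ≈ lincomb (cs ∘ suc) ((f ∘ suc) ++ g) i
    tail-split = lincomb-cong (λ _ → refl) (λ l → reflexive (≡.cong-app ([,]-map (splitAt d l)) i))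

  _∈_ : ∀ {N} → Vec N → Subspace N → Set (c ⊔ ℓ)
  v ∈ U = _∈U U v

  lincomb-∈ : ∀ {N d} (U : Subspace N) (cs : Fin d → Carrier) (bs : Fin d → Vec N) →
              (∀ l → bs l ∈ U) → lincomb cs bs ∈ U
  lincomb-∈ {d = zero}  U cs bs bs∈U = zero∈ U
  lincomb-∈ {d = suc d} U cs bs bs∈U =
    +-closed U (·-closed U (cs zero) (bs∈U zero)) (lincomb-∈ U (cs ∘ suc) (bs ∘ suc) (bs∈U ∘ suc))

  _∩_ : ∀ {N} → Subspace N → Subspace N → Subspace N
  U ∩ V = record
    { _∈U      = λ v → v ∈ U × v ∈ V
    ; resp     = λ u≈v (u∈U , u∈V) → resp U u≈v u∈U , resp V u≈v u∈V
    ; zero∈    = zero∈ U , zero∈ V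
    ; +-closed = λ (u∈U , u∈V) (v∈U , v∈V) → +-closed U u∈U v∈U , +-closed V u∈V v∈V
    ; ·-closed = λ a (v∈U , v∈V) → ·-closed U a v∈U , ·-closed V a v∈V
    }

  preimage : ∀ {M N} (L : Vec M → Vec N) → IsLinearMap L → Subspace N → Subspace M
  preimage L L-lin V = record
    { _∈U      = λ x → L x ∈ V
    ; resp     = λ x≈y → resp V (λ j → cong-≈ (L-lin j) x≈y)
    ; zero∈    = resp V (λ j → sym (preserves-0 (L-lin j))) (zero∈ V)
    ; +-closed = λ Lx∈V Ly∈V → resp V (λ j → sym (additive (L-lin j) _ _)) (+-closed V Lx∈V Ly∈V)
    ; ·-closed = λ a Lx∈V → resp V (λ j → sym (homogeneous (L-lin j) a _)) (·-closed V a Lx∈V)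
    }

  section : ∀ {N} (V : Subspace N) {f : Vec N → Carrier} → IsLinear f → Subspace N
  section V {f} f-lin = record
    { _∈U      = λ v → v ∈ V × f v ≈ 0#
    ; resp     = λ u≈v (u∈V , fu≈0) → resp V u≈v u∈V , trans (sym (cong-≈ f-lin u≈v)) fu≈0
    ; zero∈    = zero∈ V , preserves-0 f-lin
    ; +-closed = λ (u∈V , fu≈0) (v∈V , fv≈0) →
                   +-closed V u∈V v∈V , trans (additive f-lin _ _) (trans (+-cong fu≈0 fv≈0) (+-identityˡ 0#))
    ; ·-closed = λ a (v∈V , fv≈0) →
                   ·-closed V a v∈V , trans (homogeneous f-lin a _) (trans (*-congˡ fv≈0) (zeroʳ a))
    }

  whole : ∀ N → Subspace N
  whole N = record
    { _∈U = λ _ → Lift (c ⊔ ℓ) ⊤ ; resp = λ _ _ → lift tt ; zero∈ = lift tt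
    ; +-closed = λ _ _ → lift tt ; ·-closed = λ _ _ → lift tt }

  _⊕_ : ∀ {M N} → Subspace M → Subspace N → Subspace (M +ℕ N)
  _⊕_ {M} U V = record
    { _∈U      = λ x → take M x ∈ U × drop M x ∈ V
    ; resp     = λ x≈y (x₁∈ , x₂∈) → resp U (x≈y ∘ (_↑ˡ _)) x₁∈ , resp V (x≈y ∘ (M ↑ʳ_)) x₂∈
    ; zero∈    = zero∈ U , zero∈ V
    ; +-closed = λ (x₁∈ , x₂∈) (y₁∈ , y₂∈) → +-closed U x₁∈ y₁∈ , +-closed V x₂∈ y₂∈
    ; ·-closed = λ a (x₁∈ , x₂∈) → ·-closed U a x₁∈ , ·-closed V a x₂∈
    }

  IsBasis : ∀ {N d} → Subspace N → (Fin d → Vec N) → Set (c ⊔ ℓ)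
  IsBasis U b =
    (∀ i → _∈U U (b i)) ×
    (∀ (cs : Fin _ → Carrier) → lincomb cs b ≈ᵥ 0ᵥ → ∀ i → cs i ≈ 0#) ×
    (∀ v → _∈U U v → Σ (Fin _ → Carrier) λ cs → v ≈ᵥ lincomb cs b)

  dim-transport : ∀ {M N d} {X : Subspace M} {W : Subspace N} {Θ : Vec M → Vec N} → IsLinearMap Θ →
                  (∀ {x} → x ∈ X → Θ x ∈ W) →
                  (∀ {x} → x ∈ X → Θ x ≈ᵥ 0ᵥ → x ≈ᵥ 0ᵥ) →
                  (∀ {w} → w ∈ W → Σ (Vec M) λ x → x ∈ X × w ≈ᵥ Θ x) →
                  HasDim X d → HasDim W d
  dim-transport {d = d} {X = X} {W} {Θ} Θ-lin Θ-into Θ-injective Θ-onto (b , b∈X , b-indep , b-span) =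
    Θ ∘ b , (λ l → Θ-into (b∈X l)) , indep , span
    where
    indep : ∀ cs → lincomb cs (Θ ∘ b) ≈ᵥ 0ᵥ → ∀ l → cs l ≈ 0#
    indep cs Θcomb≈0 = b-indep cs (Θ-injective (lincomb-∈ X cs b b∈X)
                                   (λ j → trans (lincomb-map Θ-lin cs b j) (Θcomb≈0 j)))
    span : ∀ w → w ∈ W → Σ (Fin d → Carrier) λ cs → w ≈ᵥ lincomb cs (Θ ∘ b)
    span w w∈W with Θ-onto w∈W
    ... | x , x∈X , w≈Θx with b-span x x∈X
    ... | cs , x≈comb = cs , λ j → trans (w≈Θx j) (trans (cong-≈ (Θ-lin j) x≈comb) (lincomb-map Θ-lin cs b j))

  ↑-elim : ∀ {a b p} (P : Fin (a +ℕ b) → Set p) → (∀ i → P (i ↑ˡ b)) → (∀ j → P (a ↑ʳ j)) → ∀ k → P k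
  ↑-elim {a} P left right k with splitAt a k in eq
  ... | inj₁ i = ≡.subst P (splitAt⁻¹-↑ˡ eq) (left i)
  ... | inj₂ j = ≡.subst P (splitAt⁻¹-↑ʳ eq) (right j)

  blocks-≈ : ∀ {M N} {x y : Vec (M +ℕ N)} → take M x ≈ᵥ take M y → drop M x ≈ᵥ drop M y → x ≈ᵥ y
  blocks-≈ {x = x} {y} left right = ↑-elim (λ k → x k ≈ y k) left right

  ++-∈ : ∀ {M N} {U : Subspace M} {V : Subspace N} {u v} → u ∈ U → v ∈ V → (u ++ v) ∈ (U ⊕ V)
  ++-∈ {U = U} {V} {u} {v} u∈U v∈V =
    resp U (λ i → reflexive (≡.sym (lookup-++ˡ u v i))) u∈U , resp V (λ j → reflexive (≡.sym (lookup-++ʳ u v j))) v∈V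

  module ProductFamily {M N d e} (bU : Fin d → Vec M) (bV : Fin e → Vec N) where

    bU′ : Fin d → Vec (M +ℕ N)
    bU′ l = bU l ++ 0ᵥ
    bV′ : Fin e → Vec (M +ℕ N)
    bV′ l = 0ᵥ ++ bV l
    bs : Fin (d +ℕ e) → Vec (M +ℕ N)
    bs = bU′ ++ bV′

    left-block : ∀ cs → take M (lincomb cs bs) ≈ᵥ lincomb (take d cs) bU
    left-block cs i = trans (lincomb-++ cs bU′ bV′ (i ↑ˡ N)) (trans (+-cong
      (lincomb-cong (λ _ → refl) (λ l → reflexive (lookup-++ˡ (bU l) (0ᵥ {N}) i)))
      (lincomb-vanishing (drop d cs) bV′ (i ↑ˡ N) (λ l → trans (*-congˡ (reflexive (lookup-++ˡ (0ᵥ {M}) (bV l) i))) (zeroʳ _))))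
      (+-identityʳ _))

    right-block : ∀ cs → drop M (lincomb cs bs) ≈ᵥ lincomb (drop d cs) bV
    right-block cs j = trans (lincomb-++ cs bU′ bV′ (M ↑ʳ j)) (trans (+-cong
      (lincomb-vanishing (take d cs) bU′ (M ↑ʳ j) (λ l → trans (*-congˡ (reflexive (lookup-++ʳ (bU l) (0ᵥ {N}) j))) (zeroʳ _)))
      (lincomb-cong (λ _ → refl) (λ l → reflexive (lookup-++ʳ (0ᵥ {M}) (bV l) j))))
      (+-identityˡ _))

  dim-⊕ : ∀ {M N d e} {U : Subspace M} {V : Subspace N} → HasDim U d → HasDim V e → HasDim (U ⊕ V) (d +ℕ e)
  dim-⊕ {M} {N} {d} {e} {U} {V} (bU , bU∈U , bU-indep , bU-span) (bV , bV∈V , bV-indep , bV-span) =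
    bs , bs∈ , indep , span
    where
    open ProductFamily bU bV

    bs∈ : ∀ k → bs k ∈ (U ⊕ V)
    bs∈ = ↑-elim (λ k → bs k ∈ (U ⊕ V))
      (λ l → ≡.subst (_∈ (U ⊕ V)) (≡.sym (lookup-++ˡ bU′ bV′ l)) (++-∈ {U = U} {V} (bU∈U l) (zero∈ V)))
      (λ l → ≡.subst (_∈ (U ⊕ V)) (≡.sym (lookup-++ʳ bU′ bV′ l)) (++-∈ {U = U} {V} (zero∈ U) (bV∈V l)))

    indep : ∀ cs → lincomb cs bs ≈ᵥ 0ᵥ → ∀ k → cs k ≈ 0#
    indep cs comb≈0 = ↑-elim (λ k → cs k ≈ 0#)
      (bU-indep (take d cs) (λ i → trans (sym (left-block cs i)) (comb≈0 (i ↑ˡ N))))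
      (bV-indep (drop d cs) (λ j → trans (sym (right-block cs j)) (comb≈0 (M ↑ʳ j))))

    span : ∀ x → x ∈ (U ⊕ V) → Σ (Fin (d +ℕ e) → Carrier) λ cs → x ≈ᵥ lincomb cs bs
    span x (x₁∈U , x₂∈V) with bU-span _ x₁∈U | bV-span _ x₂∈V
    ... | α , x₁≈ | β , x₂≈ = α ++ β , blocks-≈ {M}
      (λ i → trans (x₁≈ i) (trans (lincomb-cong (λ l → reflexive (≡.sym (lookup-++ˡ α β l))) (λ _ → refl))
                                  (sym (left-block (α ++ β) i))))
      (λ j → trans (x₂≈ j) (trans (lincomb-cong (λ l → reflexive (≡.sym (lookup-++ʳ α β l))) (λ _ → refl))
                                  (sym (right-block (α ++ β) j))))

  unitVector : ∀ {N} → Fin N → Vec N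
  unitVector l i with l ≟ i
  ... | yes _ = 1#
  ... | no  _ = 0#

  lincomb-unitVector : ∀ {N} (cs : Fin N → Carrier) → lincomb cs unitVector ≈ᵥ cs
  lincomb-unitVector {suc N} cs i = begin
    lincomb cs unitVector i                                         ≈⟨ lincomb-pivot i cs unitVector i ⟩
    cs i * unitVector i i + lincomb (cs ∘ punchIn i) (unitVector ∘ punchIn i) i
                     ≈⟨ +-cong (*-congˡ diagonal) (lincomb-vanishing _ _ i (λ l → trans (*-congˡ (off-diagonal l)) (zeroʳ _))) ⟩
    cs i * 1# + 0#                                                  ≈⟨ +-identityʳ _ ⟩
    cs i * 1#                                                       ≈⟨ *-identityʳ _ ⟩
    cs i                                                            ∎
    where
    diagonal : unitVector i i ≈ 1#
    diagonal with i ≟ i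
    ... | yes _  = refl
    ... | no i≢i = contradiction ≡.refl i≢i
    off-diagonal : ∀ l → unitVector (punchIn i l) i ≈ 0#
    off-diagonal l with punchIn i l ≟ i
    ... | yes eq = contradiction eq (punchInᵢ≢i i l)
    ... | no  _  = refl

  dim-whole : ∀ N → HasDim (whole N) N
  dim-whole N = unitVector , (λ _ → lift tt)
              , (λ cs comb≈0 l → trans (sym (lincomb-unitVector cs l)) (comb≈0 l))
              , (λ v _ → v , λ i → sym (lincomb-unitVector v i))

  f≈1⇒≉0 : ∀ {N} {f : Vec N → Carrier} → IsLinear f → ∀ {e} → f e ≈ 1# → ¬ (e ≈ᵥ 0ᵥ)
  f≈1⇒≉0 f-lin fe≈1 e≈0 = 1≉0 (trans (sym fe≈1) (trans (cong-≈ f-lin e≈0) (preserves-0 f-lin)))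

  cancel-nonzero : ∀ {a b} → ¬ b ≈ 0# → a * b ≈ 0# → a ≈ 0#
  cancel-nonzero {a} {b} b≉0 ab≈0 = begin
    a                ≈⟨ *-identityʳ a ⟨
    a * 1#           ≈⟨ *-congˡ (proj₂ (inverse b b≉0)) ⟨
    a * (b * b⁻¹)    ≈⟨ *-assoc a b b⁻¹ ⟨
    (a * b) * b⁻¹    ≈⟨ *-congʳ ab≈0 ⟩
    0# * b⁻¹         ≈⟨ zeroˡ b⁻¹ ⟩
    0#               ∎
    where b⁻¹ = proj₁ (inverse b b≉0)

  -- A finite field has decidable equality: compare positions in an enumeration.
  finite⇒≈? : ∀ {q} → HasCard F q → ∀ x y → Dec (x ≈ y)
  finite⇒≈? (enum , enum-injective , enum-onto) x y with enum-onto x | enum-onto y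
  ... | i , eᵢ≈x | j , eⱼ≈y with i ≟ j
  ... | yes ≡.refl = yes (trans (sym eᵢ≈x) eⱼ≈y)
  ... | no  i≢j    = no (λ x≈y → i≢j (enum-injective i j (trans eᵢ≈x (trans x≈y (sym eⱼ≈y)))))

  module Section {N : ℕ} (V : Subspace N) {f : Vec N → Carrier} (f-lin : IsLinear f)
                 {e : Vec N} (e∈V : e ∈ V) (fe≈1 : f e ≈ 1#) where

    -- The projection T v = v - f(v) e along e onto ker f.
    project : Vec N → Vec N
    project v = v +ᵥ ((- f v) · e)

    project-linear : IsLinearMap project
    project-linear j = +-linear (coordinate-linear j) (scaled-linear (neg-linear f-lin) (e j))

    project-∈ : ∀ {v} → v ∈ V → project v ∈ section V f-lin
    project-∈ {v} v∈V = +-closed V v∈V (·-closed V (- f v) e∈V) , (begin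
      f (project v)          ≈⟨ additive f-lin v _ ⟩
      f v + f ((- f v) · e)  ≈⟨ +-congˡ (homogeneous f-lin (- f v) e) ⟩
      f v + - f v * f e      ≈⟨ +-congˡ (*-congˡ fe≈1) ⟩
      f v + - f v * 1#       ≈⟨ +-congˡ (*-identityʳ _) ⟩
      f v + - f v            ≈⟨ -‿inverseʳ (f v) ⟩
      0#                     ∎)

    project-fixes : ∀ {v} → f v ≈ 0# → project v ≈ᵥ v
    project-fixes {v} fv≈0 j = begin
      v j + - f v * e j      ≈⟨ +-congˡ (*-congʳ (trans (-‿cong fv≈0) -0#≈0#)) ⟩
      v j + 0# * e j         ≈⟨ +-congˡ (zeroˡ (e j)) ⟩
      v j + 0#               ≈⟨ +-identityʳ (v j) ⟩
      v j                    ∎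

    project-e : project e ≈ᵥ 0ᵥ
    project-e j = begin
      e j + - f e * e j      ≈⟨ +-congˡ (-‿distribˡ-* (f e) (e j)) ⟨
      e j + - (f e * e j)    ≈⟨ +-congˡ (-‿cong (trans (*-congʳ fe≈1) (*-identityˡ (e j)))) ⟩
      e j + - e j            ≈⟨ -‿inverseʳ (e j) ⟩
      0#                     ∎

    -- Let b be a basis of V in which e = Σ γ_l b_l with γ_k ≠ 0.  Then the
    -- projections of the other basis vectors form a basis of V ∩ ker f.
    module Basis {D : ℕ} (b : Fin (suc D) → Vec N) (b-basis : IsBasis V b)
                 (γ : Fin (suc D) → Carrier) (e≈γb : e ≈ᵥ lincomb γ b)
                 (k : Fin (suc D)) (γk≉0 : ¬ γ k ≈ 0#) where

      b′ : Fin D → Vec N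
      b′ l = project (b (punchIn k l))

      b-independent : ∀ cs → lincomb cs b ≈ᵥ 0ᵥ → ∀ l → cs l ≈ 0#
      b-independent = proj₁ (proj₂ b-basis)

      lifted : (Fin D → Carrier) → Carrier → Fin (suc D) → Carrier
      lifted a s l = insertAt a k 0# l + s * γ l

      lifted-lincomb : ∀ a s → lincomb (lifted a s) b ≈ᵥ (lincomb a (b ∘ punchIn k) +ᵥ (s · e))
      lifted-lincomb a s j = begin
        lincomb (lifted a s) b j                              ≈⟨ lincomb-+ (insertAt a k 0#) (λ l → s * γ l) b j ⟩
        lincomb (insertAt a k 0#) b j + lincomb (λ l → s * γ l) b j
                                                              ≈⟨ +-cong (lincomb-pivot k (insertAt a k 0#) b j) (lincomb-· s γ b j) ⟩
        (insertAt a k 0# k * b k j + lincomb (insertAt a k 0# ∘ punchIn k) (b ∘ punchIn k) j) + s * lincomb γ b j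
          ≈⟨ +-cong (+-cong (*-congʳ (reflexive (insertAt-lookup a k 0#)))
                            (lincomb-cong (λ l → reflexive (insertAt-punchIn a k 0# l)) (λ _ → refl)))
                    (*-congˡ (sym (e≈γb j))) ⟩
        (0# * b k j + lincomb a (b ∘ punchIn k) j) + s * e j  ≈⟨ +-congʳ (trans (+-congʳ (zeroˡ _)) (+-identityˡ _)) ⟩
        lincomb a (b ∘ punchIn k) j + s * e j                 ∎

      -- If Σ a_l T b_{l≠k} = T(Σ a_l b_{l≠k}) vanishes, then Σ a_l b_{l≠k}
      -- is a multiple s e of e; comparing k-th coefficients gives s γ_k = 0,
      -- so s = 0 and then every a_l = 0.
      b′-independent : ∀ a → lincomb a b′ ≈ᵥ 0ᵥ → ∀ l → a l ≈ 0#
      b′-independent a comb≈0 l = begin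
        a l                                   ≈⟨ +-identityʳ (a l) ⟨
        a l + 0#                              ≈⟨ +-congˡ (trans (*-congʳ s≈0) (zeroˡ _)) ⟨
        a l + s * γ (punchIn k l)             ≈⟨ +-congʳ (reflexive (insertAt-punchIn a k 0# l)) ⟨
        lifted a s (punchIn k l)              ≈⟨ lifted≈0 (punchIn k l) ⟩
        0#                                    ∎
        where
        s : Carrier
        s = - f (lincomb a (b ∘ punchIn k))
        lifted≈0 : ∀ l → lifted a s l ≈ 0#
        lifted≈0 = b-independent (lifted a s) (λ j →
          trans (lifted-lincomb a s j) (trans (lincomb-map project-linear a (b ∘ punchIn k) j) (comb≈0 j)))
        s≈0 : s ≈ 0#
        s≈0 = cancel-nonzero γk≉0 (begin
          s * γ k                        ≈⟨ +-identityˡ _ ⟨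
          0# + s * γ k                   ≈⟨ +-congʳ (reflexive (insertAt-lookup a k 0#)) ⟨
          lifted a s k                   ≈⟨ lifted≈0 k ⟩
          0#                             ∎)

      γk⁻¹ : Carrier
      γk⁻¹ = proj₁ (inverse (γ k) γk≉0)

      -- Subtracting (β_k / γ_k) e from Σ β_l b_l clears the k-th coefficient.
      cleared : (Fin (suc D) → Carrier) → Fin (suc D) → Carrier
      cleared β l = β l + (- (β k * γk⁻¹)) * γ l

      cleared-k : ∀ β → cleared β k ≈ 0#
      cleared-k β = begin
        β k + (- t) * γ k              ≈⟨ +-congˡ (-‿distribˡ-* t (γ k)) ⟨
        β k + - (t * γ k)              ≈⟨ +-congˡ (-‿cong (*-assoc (β k) γk⁻¹ (γ k))) ⟩
        β k + - (β k * (γk⁻¹ * γ k))   ≈⟨ +-congˡ (-‿cong (*-congˡ (trans (*-comm γk⁻¹ (γ k)) (proj₂ (inverse (γ k) γk≉0))))) ⟩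
        β k + - (β k * 1#)             ≈⟨ +-congˡ (-‿cong (*-identityʳ (β k))) ⟩
        β k + - β k                    ≈⟨ -‿inverseʳ (β k) ⟩
        0#                             ∎
        where t = β k * γk⁻¹

      cleared-lincomb : ∀ β → lincomb (cleared β ∘ punchIn k) (b ∘ punchIn k) ≈ᵥ
                              (lincomb β b +ᵥ ((- (β k * γk⁻¹)) · e))
      cleared-lincomb β i = begin
        lincomb (cleared β ∘ punchIn k) (b ∘ punchIn k) i                    ≈⟨ +-identityˡ _ ⟨
        0# + lincomb (cleared β ∘ punchIn k) (b ∘ punchIn k) i               ≈⟨ +-congʳ (trans (*-congʳ (cleared-k β)) (zeroˡ _)) ⟨
        cleared β k * b k i + lincomb (cleared β ∘ punchIn k) (b ∘ punchIn k) i ≈⟨ lincomb-pivot k (cleared β) b i ⟨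
        lincomb (cleared β) b i                                              ≈⟨ lincomb-+ β (λ l → (- t) * γ l) b i ⟩
        lincomb β b i + lincomb (λ l → (- t) * γ l) b i                      ≈⟨ +-congˡ (lincomb-· (- t) γ b i) ⟩
        lincomb β b i + (- t) * lincomb γ b i                                ≈⟨ +-congˡ (*-congˡ (e≈γb i)) ⟨
        lincomb β b i + (- t) * e i                                          ∎
        where t = β k * γk⁻¹

      -- If w ∈ V ∩ ker f has coordinates β, then w - t e (t = β_k / γ_k)
      -- is a combination of the b_{l≠k}, and w = T w = T(w - t e).
      b′-spanning : ∀ w → w ∈ section V f-lin → Σ (Fin D → Carrier) λ cs → w ≈ᵥ lincomb cs b′
      b′-spanning w (w∈V , fw≈0) with proj₂ (proj₂ b-basis) w w∈V
      ... | β , w≈βb = cleared β ∘ punchIn k , λ j → begin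
        w j                                                        ≈⟨ project-fixes fw≈0 j ⟨
        project w j                                                ≈⟨ +-identityʳ _ ⟨
        project w j + 0#                                           ≈⟨ +-congˡ (trans (*-congˡ (project-e j)) (zeroʳ _)) ⟨
        project w j + (- t) * project e j                          ≈⟨ +-congˡ (homogeneous (project-linear j) (- t) e) ⟨
        project w j + project ((- t) · e) j                        ≈⟨ additive (project-linear j) w _ ⟨
        project (w +ᵥ ((- t) · e)) j                               ≈⟨ cong-≈ (project-linear j) (λ i → +-congʳ (w≈βb i)) ⟩
        project (lincomb β b +ᵥ ((- t) · e)) j                     ≈⟨ cong-≈ (project-linear j) (cleared-lincomb β) ⟨
        project (lincomb (cleared β ∘ punchIn k) (b ∘ punchIn k)) j ≈⟨ lincomb-map project-linear _ (b ∘ punchIn k) j ⟩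
        lincomb (cleared β ∘ punchIn k) b′ j                       ∎
        where t = β k * γk⁻¹

      b′-basis : IsBasis (section V f-lin) b′
      b′-basis = (λ l → project-∈ (proj₁ b-basis (punchIn k l))) , b′-independent , b′-spanning

  module _ (≈0? : ∀ x → Dec (x ≈ 0#)) where

    nonzero-coefficient : ∀ {N d} (γ : Fin d → Carrier) (bs : Fin d → Vec N) →
                          ¬ (lincomb γ bs ≈ᵥ 0ᵥ) → Σ (Fin d) λ k → ¬ γ k ≈ 0#
    nonzero-coefficient γ bs comb≉0 with any? (λ k → ¬? (≈0? (γ k)))
    ... | yes found = found
    ... | no  none  = contradiction
      (lincomb-zero γ bs (λ k → decidable-stable (≈0? (γ k)) (λ γk≉0 → none (k , γk≉0)))) comb≉0

    dim-section : ∀ {N d} (V : Subspace N) {f : Vec N → Carrier} (f-lin : IsLinear f) {e : Vec N} →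
                  e ∈ V → f e ≈ 1# → HasDim V d → Σ ℕ λ D → d ≡ suc D × HasDim (section V f-lin) D
    dim-section {d = zero}  V f-lin e∈V fe≈1 (_ , _ , _ , b-span) =
      ⊥-elim (f≈1⇒≉0 f-lin fe≈1 (proj₂ (b-span _ e∈V)))
    dim-section {d = suc D} V f-lin e∈V fe≈1 (b , b-basis) with proj₂ (proj₂ b-basis) _ e∈V
    ... | γ , e≈γb with nonzero-coefficient γ b (λ γb≈0 → f≈1⇒≉0 f-lin fe≈1 (λ i → trans (e≈γb i) (γb≈0 i)))
    ... | k , γk≉0 = D , ≡.refl , b′ , b′-basis
      where open Section.Basis V f-lin e∈V fe≈1 b b-basis γ e≈γb k γk≉0

module Cyclic {c ℓ : Level} (F : Field c ℓ) where
  open Field F using (Carrier; _≈_; trans; reflexive; semiring; 1#)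
  open LinAlg F
  open Linear F using (_∈_)
  open import Data.Nat using (zero; suc; _+_; _*_)
  open import Data.Nat.Properties using (+-suc; +-identityʳ; ≤-refl; m<n⇒m<1+n)
  open import Data.Nat.Solver using (module +-*-Solver)
  open +-*-Solver using (solve; _:+_; _:*_; _:=_; con)
  open import Data.Nat.DivMod using (_%_; m<n⇒m%n≡m; m≤n⇒m%n≡m; [m+n]%n≡m%n)
  open import Data.Fin using (Fin; zero; suc; toℕ; inject₁)
  open import Data.Fin.Properties using (toℕ-injective; toℕ-fromℕ; toℕ-inject₁; toℕ<n)
  open import Data.Fin.Permutation using (permutation)
  open import Data.Product using (Σ; _,_; proj₂)
  open import Function using (_∘_)
  open import Relation.Binary.PropositionalEquality as ≡ using (_≡_)
  open import Algebra.Properties.Semiring.Sum semiring using (sum; ∑-permute)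

  shiftBack : ∀ {N} → ℕ → Fin N → Fin N
  shiftBack zero    k = k
  shiftBack (suc s) k = shiftBack s (prev k)

  σ^-pointwise : ∀ {N} s (x : Vec N) j → σ^ s x j ≡ x (shiftBack s j)
  σ^-pointwise zero    x j = ≡.refl
  σ^-pointwise (suc s) x j = σ^-pointwise s x (prev j)

  toℕ-prev : ∀ {N} (k : Fin (suc N)) → toℕ (prev k) ≡ (toℕ k + N) % suc N
  toℕ-prev {N} zero    = ≡.trans (toℕ-fromℕ N) (≡.sym (m≤n⇒m%n≡m ≤-refl))
  toℕ-prev {N} (suc j) = begin
    toℕ (inject₁ j)            ≡⟨ toℕ-inject₁ j ⟩
    toℕ j                      ≡⟨ m<n⇒m%n≡m (m<n⇒m<1+n (toℕ<n j)) ⟨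
    toℕ j % suc N              ≡⟨ [m+n]%n≡m%n (toℕ j) (suc N) ⟨
    (toℕ j + suc N) % suc N    ≡⟨ ≡.cong (_% suc N) (+-suc (toℕ j) N) ⟩
    (suc (toℕ j) + N) % suc N  ∎
    where open ≡.≡-Reasoning

  prev≡rotate : ∀ {N} (k : Fin (suc N)) → prev k ≡ rotate N k
  prev≡rotate {N} k = toℕ-injective (≡.trans (toℕ-prev k) (≡.sym (toℕ-rotate N k)))

  -- Hence shifting back by s is rotating by s * N ≡ -s (mod N + 1).
  shiftBack≡rotate : ∀ {N} s (k : Fin (suc N)) → shiftBack s k ≡ rotate (s * N) k
  shiftBack≡rotate zero        k = ≡.sym (rotate-zero k)
  shiftBack≡rotate {N} (suc s) k = begin
    shiftBack s (prev k)         ≡⟨ ≡.cong (shiftBack s) (prev≡rotate k) ⟩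
    shiftBack s (rotate N k)     ≡⟨ shiftBack≡rotate s (rotate N k) ⟩
    rotate (s * N) (rotate N k)  ≡⟨ rotate-rotate (s * N) N k ⟩
    rotate (N + s * N) k         ∎
    where open ≡.≡-Reasoning

  rotate-turns : ∀ {N} s (k : Fin (suc N)) → rotate (suc N * s) k ≡ k
  rotate-turns {N} s k = begin
    rotate (suc N * s) k       ≡⟨ ≡.cong (λ t → rotate t k) (+-identityʳ (suc N * s)) ⟨
    rotate (suc N * s + 0) k   ≡⟨ rotate-mod s 0 k ⟩
    rotate 0 k                 ≡⟨ rotate-zero k ⟩
    k                          ∎
    where open ≡.≡-Reasoning

  rotate-shiftBack : ∀ {N} s (k : Fin N) → rotate s (shiftBack s k) ≡ k
  rotate-shiftBack {suc N} s k = begin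
    rotate s (shiftBack s k)        ≡⟨ ≡.cong (rotate s) (shiftBack≡rotate s k) ⟩
    rotate s (rotate (s * N) k)     ≡⟨ rotate-rotate s (s * N) k ⟩
    rotate (s * N + s) k            ≡⟨ ≡.cong (λ t → rotate t k) (solve 2 (λ s N → s :* N :+ s := (con 1 :+ N) :* s) ≡.refl s N) ⟩
    rotate (suc N * s) k            ≡⟨ rotate-turns s k ⟩
    k                               ∎
    where open ≡.≡-Reasoning

  shiftBack-rotate : ∀ {N} s (k : Fin N) → shiftBack s (rotate s k) ≡ k
  shiftBack-rotate {suc N} s k = begin
    shiftBack s (rotate s k)        ≡⟨ shiftBack≡rotate s (rotate s k) ⟩
    rotate (s * N) (rotate s k)     ≡⟨ rotate-rotate (s * N) s k ⟩
    rotate (s + s * N) k            ≡⟨ ≡.cong (λ t → rotate t k) (solve 2 (λ s N → s :+ s :* N := (con 1 :+ N) :* s) ≡.refl s N) ⟩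
    rotate (suc N * s) k            ≡⟨ rotate-turns s k ⟩
    k                               ∎
    where open ≡.≡-Reasoning

  sum-rotate : ∀ {N} s (f : Fin N → Carrier) → sum f ≈ sum (f ∘ rotate s)
  sum-rotate s f = ∑-permute f (permutation (rotate s) (shiftBack s) (rotate-shiftBack s) (shiftBack-rotate s))

  RotCovering : ∀ {N} → Subspace N → Set (c ⊔ ℓ)
  RotCovering {N} U = ∀ (v : Vec N) → Σ (Fin N) λ i → (v ∘ rotate (toℕ i)) ∈ U

  covering⇒rotCovering : ∀ {N} {U : Subspace N} → CyclicallyCovering U → RotCovering U
  covering⇒rotCovering {U = U} covering v with covering v
  ... | i , u , u∈U , σⁱu≈v = i , resp U u≈v∘rotate u∈U
    where
    u≈v∘rotate : u ≈ᵥ (v ∘ rotate (toℕ i))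
    u≈v∘rotate k = trans (reflexive (≡.trans (≡.cong u (≡.sym (shiftBack-rotate (toℕ i) k)))
                                       (≡.sym (σ^-pointwise (toℕ i) u (rotate (toℕ i) k)))))
                         (σⁱu≈v (rotate (toℕ i) k))

  rotCovering⇒covering : ∀ {N} {U : Subspace N} → RotCovering U → CyclicallyCovering U
  rotCovering⇒covering covering v with covering v
  ... | i , v∘rotate∈U = i , v ∘ rotate (toℕ i) , v∘rotate∈U ,
        λ j → reflexive (≡.trans (σ^-pointwise (toℕ i) _ j) (≡.cong v (rotate-shiftBack (toℕ i) j)))

  -- A rotation-covering subspace contains the all-ones vector, which every
  -- rotation fixes.
  ones∈ : ∀ {N} {V : Subspace N} → RotCovering V → (λ _ → 1#) ∈ V
  ones∈ covering = proj₂ (covering (λ _ → 1#))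

module GridCode {c ℓ : Level} (F : Field c ℓ) (m' n' : ℕ) where
  open Field F hiding (zero)
  open LinAlg F
  open Linear F
  open Cyclic F
  open import Data.Nat using (ℕ; zero; suc) renaming (_+_ to _+ℕ_; _*_ to _*ℕ_)
  open import Data.Nat.Properties using (suc-injective)
  open import Data.Nat.DivMod using (_/_)
  open import Data.Nat.Solver using (module +-*-Solver)
  open +-*-Solver using (solve; _:+_; _:*_; _:=_; con)
  open import Data.Fin using (Fin; zero; suc; toℕ; combine; remQuot; _↑ˡ_; _↑ʳ_)
  open import Data.Fin.Properties using (toℕ-combine)
  open import Data.Vec.Functional using (_++_; take; drop)
  open import Data.Vec.Functional.Properties using (lookup-++ˡ; lookup-++ʳ)
  open import Data.Product using (_,_; proj₁; proj₂)
  open import Data.Unit using (tt)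
  open import Function using (_∘_)
  open import Relation.Nullary using (Dec)
  open import Relation.Binary.PropositionalEquality as ≡ using (_≡_)
  open import Algebra.Properties.Semiring.Sum semiring using (sum; sum-cong-≋; sum-replicate-zero)
  open import Algebra.Properties.Ring ring using (-0#≈0#)
  open import Relation.Binary.Reasoning.Setoid setoid

  m n : ℕ
  m = suc m'
  n = suc n'

  𝟙 : Vec n
  𝟙 _ = 1#

  firstColumn : Vec (m *ℕ n) → Vec m
  firstColumn x i = x (combine i zero)

  columnSums : Vec (m *ℕ n) → Vec n
  columnSums x j = sum (λ i → x (combine {m} {n} i j))

  firstColumn-linear : IsLinearMap firstColumn
  firstColumn-linear i = coordinate-linear (combine i zero)

  columnSums-linear : IsLinearMap columnSums
  columnSums-linear j = sum-linear (λ i → coordinate-linear (combine {m} {n} i j))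

  gridSubspace : Subspace m → Subspace n → Subspace (m *ℕ n)
  gridSubspace U V = preimage firstColumn firstColumn-linear U ∩ preimage columnSums columnSums-linear V

  -- Given a matrix v, rotate by b (a column shift found by V) so
  -- that the column sums fall in V, then by whole rows a (found by U) so that
  -- the first column falls in U; rotating by whole rows does not disturb the
  -- column sums.
  gridSubspace-covering : ∀ {U V} → RotCovering U → RotCovering V → RotCovering (gridSubspace U V)
  gridSubspace-covering {U} {V} U-covering V-covering v with V-covering (columnSums v)
  ... | b , sums∈V with U-covering (λ i → v (rotate (toℕ b) (combine i zero)))
  ... | a , column∈U = combine a b , resp U first-column column∈U , resp V column-sums sums∈V
    where
    s : ℕ
    s = toℕ (combine a b)
    s≡ : s ≡ n *ℕ toℕ a +ℕ toℕ b
    s≡ = toℕ-combine a b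

    first-column : ∀ i → v (rotate (toℕ b) (combine (rotate (toℕ a) i) zero)) ≈ v (rotate s (combine i zero))
    first-column i = begin
      v (rotate (toℕ b) (combine (rotate (toℕ a) i) zero))      ≡⟨ ≡.cong (v ∘ rotate (toℕ b)) (rotate-rows (toℕ a) i zero) ⟨
      v (rotate (toℕ b) (rotate (n *ℕ toℕ a) (combine i zero)))  ≡⟨ ≡.cong v (rotate-rotate (toℕ b) (n *ℕ toℕ a) (combine i zero)) ⟩
      v (rotate (n *ℕ toℕ a +ℕ toℕ b) (combine i zero))          ≡⟨ ≡.cong (λ t → v (rotate t (combine i zero))) s≡ ⟨
      v (rotate s (combine i zero))                              ∎

    column-sums : ∀ j → columnSums v (rotate (toℕ b) j) ≈ columnSums (v ∘ rotate s) j
    column-sums j = begin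
      columnSums v (rotate (toℕ b) j)                              ≡⟨ ≡.cong (columnSums v) (rotate-mod (toℕ a) (toℕ b) j) ⟨
      columnSums v (rotate (n *ℕ toℕ a +ℕ toℕ b) j)               ≡⟨ ≡.cong (λ t → columnSums v (rotate t j)) s≡ ⟨
      sum (λ i → v (combine {m} {n} i (rotate s j)))               ≈⟨ sum-rotate {m} carry (λ i → v (combine i (rotate s j))) ⟩
      sum (λ i → v (combine {m} {n} (rotate carry i) (rotate s j))) ≈⟨ sum-cong-≋ {m} (λ i → reflexive (≡.cong v (rotate-combine s i j))) ⟨
      columnSums (v ∘ rotate s) j                                  ∎
      where
      carry : ℕ
      carry = (toℕ j +ℕ s) / n

  -- Dimension.  gridSubspace U V is parametrised by
  --   u ∈ U (the first column), w ∈ V with w₀ = 0, and c ∈ F^((m-1)(n-1)):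
  -- the matrix has first column u, entries c(i, j) at (i+1, j+1), and the
  -- entry Σu + w_{j+1} - Σ_i c(i, j) at (0, j+1); its column sums are Σu·𝟙 + w.
  P : ℕ
  P = m +ℕ (n +ℕ m' *ℕ n')

  parameters : Subspace m → Subspace n → Subspace P
  parameters U V = U ⊕ (section V (coordinate-linear zero) ⊕ whole (m' *ℕ n'))

  paramU : Vec P → Vec m
  paramU = take m
  paramW : Vec P → Vec n
  paramW x = take n (drop m x)
  paramC : Vec P → Fin m' → Fin n' → Carrier
  paramC x i j = drop n (drop m x) (combine i j)

  entry : Vec P → Fin m → Fin n → Carrier
  entry x i       zero    = paramU x i
  entry x zero    (suc j) = sum (paramU x) + paramW x (suc j) + - sum (λ i → paramC x i j)
  entry x (suc i) (suc j) = paramC x i j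

  embed : Vec P → Vec (m *ℕ n)
  embed x = grid (entry x)

  entry-linear : ∀ i j → IsLinear (λ x → entry x i j)
  entry-linear i       zero    = coordinate-linear (i ↑ˡ _)
  entry-linear zero    (suc j) =
    +-linear (+-linear (sum-linear {K = m} (λ i → coordinate-linear (i ↑ˡ _))) (coordinate-linear (m ↑ʳ (suc j ↑ˡ _))))
             (neg-linear (sum-linear {K = m'} (λ i → coordinate-linear (m ↑ʳ (n ↑ʳ combine i j)))))
  entry-linear (suc i) (suc j) = coordinate-linear (m ↑ʳ (n ↑ʳ combine i j))

  embed-linear : IsLinearMap embed
  embed-linear k = entry-linear (proj₁ (remQuot {m} n k)) (proj₂ (remQuot {m} n k))

  embed-at : ∀ x i j → embed x (combine i j) ≈ entry x i j
  embed-at x i j = reflexive (grid-combine (entry x) i j)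

  neg-cancel : ∀ x y → (x + - y) + y ≈ x
  neg-cancel x y = trans (+-assoc x (- y) y) (trans (+-congˡ (-‿inverseˡ y)) (+-identityʳ x))

  cancel-neg : ∀ x y → (x + y) + - y ≈ x
  cancel-neg x y = trans (+-assoc x y (- y)) (trans (+-congˡ (-‿inverseʳ y)) (+-identityʳ x))

  embed-firstColumn : ∀ x → firstColumn (embed x) ≈ᵥ paramU x
  embed-firstColumn x i = embed-at x i zero

  embed-columnSums : ∀ x → paramW x zero ≈ 0# → columnSums (embed x) ≈ᵥ ((sum (paramU x) · 𝟙) +ᵥ paramW x)
  embed-columnSums x w₀≈0 zero = begin
    sum (λ i → embed x (combine {m} {n} i zero))      ≈⟨ sum-cong-≋ {m} (λ i → embed-at x i zero) ⟩
    sum (paramU x)                                    ≈⟨ *-identityʳ _ ⟨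
    sum (paramU x) * 1#                               ≈⟨ +-identityʳ _ ⟨
    sum (paramU x) * 1# + 0#                          ≈⟨ +-congˡ w₀≈0 ⟨
    sum (paramU x) * 1# + paramW x zero               ∎
  embed-columnSums x w₀≈0 (suc j) = begin
    sum (λ i → embed x (combine {m} {n} i (suc j)))   ≈⟨ sum-cong-≋ {m} (λ i → embed-at x i (suc j)) ⟩
    (S + paramW x (suc j) + - C) + C                  ≈⟨ neg-cancel _ C ⟩
    S + paramW x (suc j)                              ≈⟨ +-congʳ (*-identityʳ S) ⟨
    S * 1# + paramW x (suc j)                         ∎
    where
    S = sum (paramU x)
    C = sum (λ i → paramC x i j)

  embed-into : ∀ {U V x} → RotCovering V → x ∈ parameters U V → embed x ∈ gridSubspace U V
  embed-into {U} {V} {x} V-covering (u∈U , (w∈V , w₀≈0) , _) =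
    resp U (λ i → sym (embed-firstColumn x i)) u∈U ,
    resp V (λ j → sym (embed-columnSums x w₀≈0 j)) (+-closed V (·-closed V (sum (paramU x)) (ones∈ {V = V} V-covering)) w∈V)

  embed-injective : ∀ {U V x} → x ∈ parameters U V → embed x ≈ᵥ 0ᵥ → x ≈ᵥ 0ᵥ
  embed-injective {x = x} (_ , (_ , w₀≈0) , _) embed≈0 = blocks-≈ {m} u≈0 (blocks-≈ {n} w≈0 c≈0)
    where
    entry≈0 : ∀ i j → entry x i j ≈ 0#
    entry≈0 i j = trans (sym (embed-at x i j)) (embed≈0 (combine i j))
    u≈0 : ∀ i → paramU x i ≈ 0#
    u≈0 i = entry≈0 i zero
    c≈0 : ∀ k → drop n (drop m x) k ≈ 0#
    c≈0 = grid-elim (λ k → drop n (drop m x) k ≈ 0#) (λ i j → entry≈0 (suc i) (suc j))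
    w≈0 : ∀ j → paramW x j ≈ 0#
    w≈0 zero    = w₀≈0
    w≈0 (suc j) = begin
      paramW x (suc j)                                                ≈⟨ trans (+-congˡ -0#≈0#) (+-identityʳ _) ⟨
      paramW x (suc j) + - 0#                                         ≈⟨ +-congʳ (+-identityˡ _) ⟨
      (0# + paramW x (suc j)) + - 0#                                  ≈⟨ +-cong (+-congʳ S≈0) (-‿cong C≈0) ⟨
      (sum (paramU x) + paramW x (suc j)) + - sum (λ i → paramC x i j) ≈⟨ entry≈0 zero (suc j) ⟩
      0#                                                              ∎
      where
      S≈0 : sum (paramU x) ≈ 0#
      S≈0 = trans (sum-cong-≋ {m} u≈0) (sum-replicate-zero m)
      C≈0 : sum (λ i → paramC x i j) ≈ 0#
      C≈0 = trans (sum-cong-≋ {m'} (λ i → c≈0 (combine i j))) (sum-replicate-zero m')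

  correctedSums : Vec (m *ℕ n) → Vec n
  correctedSums y = columnSums y +ᵥ ((- sum (firstColumn y)) · 𝟙)

  interior : Vec (m *ℕ n) → Vec (m' *ℕ n')
  interior y = grid {a = m'} {b = n'} (λ i j → y (combine {m} {n} (suc i) (suc j)))

  unembed : Vec (m *ℕ n) → Vec P
  unembed y = firstColumn y ++ (correctedSums y ++ interior y)

  unembed-∈ : ∀ {U V y} → RotCovering V → y ∈ gridSubspace U V → unembed y ∈ parameters U V
  unembed-∈ {U} {V} {y} V-covering (column∈U , sums∈V) =
    ++-∈ {U = U} {V = section V (coordinate-linear zero) ⊕ whole (m' *ℕ n')} column∈U
      (++-∈ {U = section V (coordinate-linear zero)} {V = whole (m' *ℕ n')}
            (+-closed V sums∈V (·-closed V (- S) (ones∈ {V = V} V-covering)) ,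
             trans (+-congˡ (*-identityʳ _)) (-‿inverseʳ S))
            (lift tt))
    where
    S : Carrier
    S = sum (firstColumn y)

  embed-unembed : ∀ y → y ≈ᵥ embed (unembed y)
  embed-unembed y = grid-elim (λ k → y k ≈ embed x k) (λ i j → trans (y≈entry i j) (sym (embed-at x i j)))
    where
    x : Vec P
    x = unembed y
    u-of : ∀ i → paramU x i ≡ firstColumn y i
    u-of i = lookup-++ˡ (firstColumn y) (correctedSums y ++ interior y) i
    w-of : ∀ j → paramW x j ≡ correctedSums y j
    w-of j = ≡.trans (lookup-++ʳ (firstColumn y) (correctedSums y ++ interior y) (j ↑ˡ _))
                     (lookup-++ˡ (correctedSums y) (interior y) j)
    c-of : ∀ i j → paramC x i j ≡ y (combine {m} {n} (suc i) (suc j))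
    c-of i j = ≡.trans (lookup-++ʳ (firstColumn y) (correctedSums y ++ interior y) (n ↑ʳ combine i j))
                 (≡.trans (lookup-++ʳ (correctedSums y) (interior y) (combine i j))
                          (grid-combine {a = m'} {b = n'} (λ i j → y (combine {m} {n} (suc i) (suc j))) i j))

    y≈entry : ∀ i j → y (combine i j) ≈ entry x i j
    y≈entry i       zero    = reflexive (≡.sym (u-of i))
    y≈entry (suc i) (suc j) = reflexive (≡.sym (c-of i j))
    y≈entry zero    (suc j) = begin
      Y                                                                ≈⟨ cancel-neg Y R ⟨
      (Y + R) + - R                                                    ≈⟨ +-congʳ (neg-cancel (Y + R) S) ⟨
      ((Y + R) + - S + S) + - R                                        ≈⟨ +-congʳ (+-comm S _) ⟨
      (S + ((Y + R) + - S)) + - R                                      ≈⟨ +-congʳ (+-congˡ (+-congˡ (*-identityʳ _))) ⟨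
      (S + correctedSums y (suc j)) + - R                              ≈⟨ +-cong (+-cong S≈ (reflexive (≡.sym (w-of (suc j)))))
                                                                                 (-‿cong (sum-cong-≋ {m'} (λ i → reflexive (≡.sym (c-of i j))))) ⟩
      (sum (paramU x) + paramW x (suc j)) + - sum (λ i → paramC x i j) ∎
      where
      Y R S : Carrier
      Y = y (combine {m} {n} zero (suc j))
      R = sum (λ i → y (combine {m} {n} (suc i) (suc j)))
      S = sum (firstColumn y)
      S≈ : S ≈ sum (paramU x)
      S≈ = sum-cong-≋ {m} (λ i → reflexive (≡.sym (u-of i)))

  codim-count : ∀ {dU hU D hV} → dU +ℕ hU ≡ m → suc D +ℕ hV ≡ n →
                (dU +ℕ (D +ℕ m' *ℕ n')) +ℕ (hU +ℕ hV) ≡ m *ℕ n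
  codim-count {dU} {hU} {D} {hV} dU+hU≡m D+1+hV≡n = ≡.trans
    (solve 6 (λ dU hU D hV m' n' → (dU :+ (D :+ m' :* n')) :+ (hU :+ hV) := (dU :+ hU) :+ (D :+ hV) :+ m' :* n')
           ≡.refl dU hU D hV m' n')
    (≡.trans (≡.cong₂ (λ a b → a +ℕ b +ℕ m' *ℕ n') dU+hU≡m (suc-injective D+1+hV≡n))
             (solve 2 (λ m' n' → (con 1 :+ m') :+ n' :+ m' :* n' := (con 1 :+ m') :* (con 1 :+ n')) ≡.refl m' n'))

  gridSubspace-codim : ∀ {U V hU hV} → (∀ a → Dec (a ≈ 0#)) → RotCovering V →
                       HasCodim U hU → HasCodim V hV → HasCodim (gridSubspace U V) (hU +ℕ hV)
  gridSubspace-codim {U} {V} {hU} {hV} ≈0? V-covering (dU , dimU , dU+hU≡m) (dV , dimV , dV+hV≡n)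
    with dim-section ≈0? V (coordinate-linear zero) (ones∈ {V = V} V-covering) refl dimV
  ... | D , ≡.refl , dimV₀ = dU +ℕ (D +ℕ m' *ℕ n') , dimW , codim-count {dU} {hU} {D} {hV} dU+hU≡m dV+hV≡n
    where
    V₀ : Subspace n
    V₀ = section V (coordinate-linear zero)
    dimW : HasDim (gridSubspace U V) (dU +ℕ (D +ℕ m' *ℕ n'))
    dimW = dim-transport {X = parameters U V} {W = gridSubspace U V} embed-linear
             (embed-into {U} {V} V-covering)
             (embed-injective {U} {V})
             (λ {y} y∈W → unembed y , unembed-∈ {U} {V} {y} V-covering y∈W , embed-unembed y)
             (dim-⊕ {U = U} {V = V₀ ⊕ whole (m' *ℕ n')} dimU
               (dim-⊕ {U = V₀} {V = whole (m' *ℕ n')} dimV₀ (dim-whole (m' *ℕ n'))))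

open import Data.Nat using (zero; suc; _+_; _*_; _≤_)
open import Data.Product using (_,_)

theorem6p1 : ∀ {c ℓ : Level} (q : ℕ) → IsPrimePower q →
    (F : Field c ℓ) → HasCard F q →
    ∀ (m n hm hn hmn : ℕ) →
    LinAlg.IsH F m hm → LinAlg.IsH F n hn → LinAlg.IsH F (m * n) hmn →
    hm + hn ≤ hmn
-- F^0 has no cyclically covering subspace: there is no shift to choose.
theorem6p1 q _ F card zero n hm hn hmn ((U , U-covering , _) , _) _ _ with U-covering (λ ())
... | () , _
theorem6p1 q _ F card (suc m') zero hm hn hmn _ ((V , V-covering , _) , _) _ with V-covering (λ ())
... | () , _
theorem6p1 q _ F card (suc m') (suc n') hm hn hmn ((U , U-covering , U-codim) , _) ((V , V-covering , V-codim) , _)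
           (_ , maximal) =
  maximal (gridSubspace U V) (hm + hn)
    (rotCovering⇒covering {U = gridSubspace U V} (gridSubspace-covering {U} {V} U-rotCovering V-rotCovering))
    (gridSubspace-codim {U} {V} (λ a → finite⇒≈? card a 0#) V-rotCovering U-codim V-codim)
  where
  open Field F using (0#)
  open Linear F using (finite⇒≈?)
  open Cyclic F
  open GridCode F m' n'
  U-rotCovering : RotCovering U
  U-rotCovering = covering⇒rotCovering {U = U} U-covering
  V-rotCovering : RotCovering V
  V-rotCovering = covering⇒rotCovering {U = V} V-covering
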